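{- Every graph that has exactly one component containing an edge, this component being an amaryllis (all other components being isolated vertices), is line $[B,-]$-nice.
   Context: For $m,n\in\mathbb N$, an $(m,n)$-amaryllis has vertices $v,w,c_1,c_2,x_1,\dots,x_m,y_1,\dots,y_n$ and edges $wv,vc_1,c_1c_2,c_2v$, $wx_i$ ($1\le i\le m$) and $vy_j$ ($1\le j\le n$). In the $[B,-]$-edge colouring game with $k$ colours, Bob and Alice alternately colour a previously uncoloured edge with one of $k$ colours so that edges sharing an endpoint get distinct colours; Bob moves first; no player may skip. The game ends when no move is possible; Alice wins iff all edges are coloured. A graph $G$ is line $[B,-]$-nice if the least $k$ for which Alice has a winning strategy equals $\omega(L(G))$, the maximum number of pairwise adjacent edges of $G$. -}

module Defs where

open import Data.Nat using (ℕ; _<_; _≤_)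
open import Data.Fin as Fin using (Fin)
open import Data.Bool using (Bool; true; false; if_then_else_; _∧_)
open import Data.Maybe using (Maybe; just; nothing)
open import Data.Product using (Σ; Σ-syntax; ∃; ∃-syntax; _×_; _,_; proj₁; proj₂)
open import Data.Sum using (_⊎_)
open import Data.List using (List; length)
open import Data.List.Relation.Unary.AllPairs using (AllPairs)
open import Relation.Binary.PropositionalEquality using (_≡_; _≢_)
open import Relation.Nullary using (¬_; does)

record Graph : Set where
  field
    V      : ℕ
    adj    : Fin V → Fin V → Bool
    sym    : ∀ u v → adj u v ≡ adj v u
    irrefl : ∀ u → adj u u ≡ false

open Graph public

record Edge (G : Graph) : Set where
  constructor edge
  field
    end₁   : Fin (V G)
    end₂   : Fin (V G)
    ordered : end₁ Fin.< end₂
    isEdge : adj G end₁ end₂ ≡ true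

open Edge public

ShareEnd : ∀ {G} → Edge G → Edge G → Set
ShareEnd e f =
  (end₁ e ≡ end₁ f) ⊎ (end₁ e ≡ end₂ f) ⊎ (end₂ e ≡ end₁ f) ⊎ (end₂ e ≡ end₂ f)

DistinctEdges : ∀ {G} → Edge G → Edge G → Set
DistinctEdges e f = ¬ ((end₁ e ≡ end₁ f) × (end₂ e ≡ end₂ f))

IsLineClique : (G : Graph) → List (Edge G) → Set
IsLineClique G es = AllPairs (λ e f → DistinctEdges e f × ShareEnd e f) es

LineCliqueNumber : Graph → ℕ → Set
LineCliqueNumber G ω =
  (Σ[ es ∈ List (Edge G) ] (IsLineClique G es × length es ≡ ω))
  × (∀ (es : List (Edge G)) → IsLineClique G es → length es ≤ ω)

-- partial edge colouring: nothing = uncoloured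
Colouring : Graph → ℕ → Set
Colouring G k = Edge G → Maybe (Fin k)

emptyCol : ∀ {G k} → Colouring G k
emptyCol _ = nothing

Legal : ∀ {G k} → Colouring G k → Edge G → Fin k → Set
Legal c e a = (c e ≡ nothing) × (∀ f → ShareEnd e f → c f ≢ just a)

update : ∀ {G k} → Colouring G k → Edge G → Fin k → Colouring G k
update c e a f =
  if does (end₁ f Fin.≟ end₁ e) ∧ does (end₂ f Fin.≟ end₂ e) then just a else c f

Complete : ∀ {G k} → Colouring G k → Set
Complete c = ∀ e → ∃[ a ] (c e ≡ just a)

-- Alice can force a win from position c, with Bob (resp. Alice) to move.
-- The game ends when no legal move is possible; Alice wins iff all edges
-- are coloured.  No player may skip.
mutual
  data BobTurn {G : Graph} {k : ℕ} (c : Colouring G k) : Set where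
    bob-done : Complete c → BobTurn c
    bob-move : (Σ[ e ∈ Edge G ] Σ[ a ∈ Fin k ] Legal c e a)
             → (∀ e a → Legal c e a → AliceTurn (update c e a))
             → BobTurn c

  data AliceTurn {G : Graph} {k : ℕ} (c : Colouring G k) : Set where
    alice-done : Complete c → AliceTurn c
    alice-move : ∀ e a → Legal c e a → BobTurn (update c e a) → AliceTurn c

AliceWinsB : Graph → ℕ → Set
AliceWinsB G k = BobTurn {G} {k} emptyCol

GameChromaticIndexB : Graph → ℕ → Set
GameChromaticIndexB G χ = AliceWinsB G χ × (∀ k → k < χ → ¬ AliceWinsB G k)

LineBNice : Graph → Set
LineBNice G = Σ[ ω ∈ ℕ ] (LineCliqueNumber G ω × GameChromaticIndexB G ω)

data AmV (m n : ℕ) : Set where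
  av aw ac₁ ac₂ : AmV m n
  ax : Fin m → AmV m n
  ay : Fin n → AmV m n

amAdj : ∀ {m n} → AmV m n → AmV m n → Bool
amAdj aw av = true
amAdj av aw = true
amAdj av ac₁ = true
amAdj ac₁ av = true
amAdj ac₁ ac₂ = true
amAdj ac₂ ac₁ = true
amAdj ac₂ av = true
amAdj av ac₂ = true
amAdj aw (ax _) = true
amAdj (ax _) aw = true
amAdj av (ay _) = true
amAdj (ay _) av = true
amAdj _ _ = false

-- G consists of an (m,n)-amaryllis (embedded via φ as an induced subgraph)
-- together with isolated vertices: every edge of G lies inside the image of φ.
AmaryllisPlusIsolated : Graph → ℕ → ℕ → Set
AmaryllisPlusIsolated G m n =
  Σ[ φ ∈ (AmV m n → Fin (V G)) ]
    ((∀ a b → φ a ≡ φ b → a ≡ b)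
    × (∀ a b → adj G (φ a) (φ b) ≡ amAdj a b)
    × (∀ u v → adj G u v ≡ true → (∃[ a ] (φ a ≡ u)) × (∃[ b ] (φ b ≡ v))))

-- Every clique of the line graph of an (m,n)-amaryllis lies in the star of v, the star of w or the triangle
-- vc₁c₂, so ω = max(n + 3, m + 1).  Alice cannot win with fewer colours, since every colouring reached in
-- the game is proper.  With ω colours she steers towards an invariant that survives every move and leaves
-- each uncoloured edge a free colour; from then on she wins by colouring any edge with a free colour.
-- If m ≥ n + 3 the invariant is just "wv is coloured".  Otherwise ω = n + 3 = deg v, and vc₁, vc₂ have
-- n + 3 neighbours, so she also needs c₁c₂ to repeat a colour of the star at v (or vc₁ and vc₂ to be
-- coloured); a case analysis of Bob's first two or three moves shows she gets there in time.  When n = 0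
-- only three colours are available; she then gives vc₁ or vc₂ and a pendant edge at w the same colour, so
-- that wv keeps a free colour.

module Submission where

open import Defs hiding (sym)
open import Data.Nat as ℕ using (ℕ; zero; suc; _+_; _≤_; _<_; z≤n; s≤s)
import Data.Nat.Properties as ℕP
open import Data.Nat.Induction using (<-wellFounded)
open import Induction.WellFounded using (Acc; acc)
open import Data.Fin as Fin using (Fin)
import Data.Fin.Properties as FinP
open import Data.Bool using (true)
import Data.Bool.Properties as BoolP
open import Data.Unit using (tt)
open import Data.Empty using (⊥; ⊥-elim)
open import Data.Maybe using (Maybe; just; nothing)
open import Data.Maybe.Properties using (just-injective)
open import Data.Product using (∃; ∃₂; ∃-syntax; _×_; _,_; proj₁; proj₂)
open import Data.Sum using (_⊎_; inj₁; inj₂)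
open import Data.List using (List; []; _∷_; length; lookup; map; mapMaybe; tabulate; allFin; _++_)
open import Data.List.Properties using (length-tabulate; length-map; length-mapMaybe)
open import Data.List.Relation.Unary.All as All using (All; []; _∷_)
open import Data.List.Relation.Unary.Any as Any using (here; there)
open import Data.List.Relation.Unary.Any.Properties using (lookup-index)
open import Data.List.Relation.Unary.AllPairs as AllPairs using (AllPairs; []; _∷_)
import Data.List.Relation.Unary.AllPairs.Properties as AllPairsₚ
open import Data.List.Relation.Unary.Unique.Propositional using (Unique)
open import Data.List.Relation.Unary.Unique.Propositional.Properties using (allFin⁺)
open import Data.List.Relation.Binary.Subset.Propositional using (_⊆_)
open import Data.List.Relation.Binary.Permutation.Propositional using (_↭_; ↭-sym; ↭-refl; swap)
open import Data.List.Relation.Binary.Permutation.Propositional.Properties using (∈-resp-↭)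
open import Data.List.Membership.Propositional using (_∈_; _∉_; find)
open import Data.List.Membership.Propositional.Properties
  using (∈-lookup; ∈-allFin; ∈-tabulate⁺; ∈-++⁺ˡ; ∈-++⁺ʳ; ∈-map⁺)
import Data.List.Membership.DecPropositional as DecMembership
open import Relation.Binary using (tri<; tri≈; tri>)
open import Relation.Binary.PropositionalEquality
open import Relation.Nullary using (¬_; Dec; yes; no; contradiction)
open import Relation.Nullary.Decidable using (_×-dec_; dec-true; False; toWitnessFalse)
open import Axiom.UniquenessOfIdentityProofs using (module Decidable⇒UIP)
open import Function using (_∘_)

lookup-injective : ∀ {a} {A : Set a} {xs : List A} → Unique xs →
                   ∀ {i j} → lookup xs i ≡ lookup xs j → i ≡ j
lookup-injective (x∉ ∷ u) {Fin.zero}  {Fin.zero}  _  = refl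
lookup-injective (x∉ ∷ u) {Fin.zero}  {Fin.suc j} eq = ⊥-elim (All.lookup x∉ (∈-lookup j) eq)
lookup-injective (x∉ ∷ u) {Fin.suc i} {Fin.zero}  eq = ⊥-elim (All.lookup x∉ (∈-lookup i) (sym eq))
lookup-injective (x∉ ∷ u) {Fin.suc i} {Fin.suc j} eq = cong Fin.suc (lookup-injective u eq)

unique-⊆⇒length≤ : ∀ {a} {A : Set a} {xs ys : List A} → Unique xs → xs ⊆ ys → length xs ≤ length ys
unique-⊆⇒length≤ {xs = xs} {ys} u xs⊆ys = FinP.injective⇒≤ position-injective
  where
  position : Fin (length xs) → Fin (length ys)
  position i = Any.index (xs⊆ys (∈-lookup i))

  position-injective : ∀ {i j} → position i ≡ position j → i ≡ j
  position-injective {i} {j} eq = lookup-injective u (begin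
    lookup xs i                  ≡⟨ lookup-index (xs⊆ys (∈-lookup i)) ⟩
    lookup ys (position i)       ≡⟨ cong (lookup ys) eq ⟩
    lookup ys (position j)       ≡⟨ lookup-index (xs⊆ys (∈-lookup j)) ⟨
    lookup xs j                  ∎)
    where open ≡-Reasoning

length-allFin : ∀ N → length (allFin N) ≡ N
length-allFin N = length-tabulate {n = N} (λ i → i)

unique-length≤ : ∀ {N} {xs : List (Fin N)} → Unique xs → length xs ≤ N
unique-length≤ {N} {xs} u =
  subst (length xs ≤_) (length-allFin N) (unique-⊆⇒length≤ u (λ {x} _ → ∈-allFin x))

∃∉ : ∀ {k} (L : List (Fin k)) → length L < k → ∃ λ α → α ∉ L
∃∉ {k} L L<k = FinP.¬∀⟶∃¬ k (_∈ L) (λ α → α ∈? L) λ all∈L →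
  ℕP.<⇒≱ L<k (subst (_≤ length L) (length-allFin k)
                     (unique-⊆⇒length≤ (allFin⁺ k) (λ {α} _ → all∈L α)))
  where open DecMembership FinP._≟_ using (_∈?_)

third-unique : ∀ {k} → k ≤ 3 → (a b x y : Fin k) →
               a ≢ b → x ≢ a → x ≢ b → y ≢ a → y ≢ b → x ≡ y
third-unique k≤3 a b x y a≢b x≢a x≢b y≢a y≢b with x FinP.≟ y
... | yes x≡y = x≡y
... | no x≢y = ⊥-elim (ℕP.<⇒≱ (s≤s k≤3) (unique-length≤ distinct))
  where
  distinct : Unique (a ∷ b ∷ x ∷ y ∷ [])
  distinct = (a≢b ∷ (λ a≡x → x≢a (sym a≡x)) ∷ (λ a≡y → y≢a (sym a≡y)) ∷ [])
           ∷ ((λ b≡x → x≢b (sym b≡x)) ∷ (λ b≡y → y≢b (sym b≡y)) ∷ [])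
           ∷ (x≢y ∷ []) ∷ [] ∷ []

no-three-distinct : ∀ {m} → m ≤ 2 → (a b c : Fin m) → a ≢ b → a ≢ c → b ≢ c → ⊥
no-three-distinct m≤2 a b c a≢b a≢c b≢c =
  ℕP.<⇒≱ (s≤s m≤2) (unique-length≤ ((a≢b ∷ a≢c ∷ []) ∷ (b≢c ∷ []) ∷ [] ∷ []))

inhabited-or-empty : ∀ m → Fin m ⊎ ¬ Fin m
inhabited-or-empty zero    = inj₂ λ ()
inhabited-or-empty (suc m) = inj₁ Fin.zero

SamePair : ∀ {A : Set} → A → A → A → A → Set
SamePair x y u v = (x ≡ u × y ≡ v) ⊎ (x ≡ v × y ≡ u)

same-pair-sym : ∀ {A : Set} {x y u v : A} → SamePair x y u v → SamePair u v x y
same-pair-sym (inj₁ (p , q)) = inj₁ (sym p , sym q)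
same-pair-sym (inj₂ (p , q)) = inj₂ (sym q , sym p)

same-pair-trans : ∀ {A : Set} {x y u v s t : A} → SamePair x y u v → SamePair u v s t → SamePair x y s t
same-pair-trans (inj₁ (p , q)) (inj₁ (p′ , q′)) = inj₁ (trans p p′ , trans q q′)
same-pair-trans (inj₁ (p , q)) (inj₂ (p′ , q′)) = inj₂ (trans p p′ , trans q q′)
same-pair-trans (inj₂ (p , q)) (inj₁ (p′ , q′)) = inj₂ (trans p q′ , trans q p′)
same-pair-trans (inj₂ (p , q)) (inj₂ (p′ , q′)) = inj₁ (trans p q′ , trans q p′)

same-pair-map : ∀ {A B : Set} (f : A → B) {x y u v} → SamePair x y u v → SamePair (f x) (f y) (f u) (f v)
same-pair-map f (inj₁ (p , q)) = inj₁ (cong f p , cong f q)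
same-pair-map f (inj₂ (p , q)) = inj₂ (cong f p , cong f q)

same-pair-injective : ∀ {A B : Set} {f : A → B} → (∀ {a b} → f a ≡ f b → a ≡ b) →
                      ∀ {x y u v} → SamePair (f x) (f y) (f u) (f v) → SamePair x y u v
same-pair-injective inj (inj₁ (p , q)) = inj₁ (inj p , inj q)
same-pair-injective inj (inj₂ (p , q)) = inj₂ (inj p , inj q)

module _ {G : Graph} where

  SameEnds : Edge G → Edge G → Set
  SameEnds e f = end₁ e ≡ end₁ f × end₂ e ≡ end₂ f

  same-ends? : ∀ e f → Dec (SameEnds e f)
  same-ends? e f = (end₁ e FinP.≟ end₁ f) ×-dec (end₂ e FinP.≟ end₂ f)

  Edge-ext : ∀ {e f} → SameEnds e f → e ≡ f
  Edge-ext {edge u v u<v uv} {edge .u .v u<v′ uv′} (refl , refl) =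
    cong₂ (edge u v) (FinP.<-irrelevant u<v u<v′) (Decidable⇒UIP.≡-irrelevant BoolP._≟_ uv uv′)

  IsEnd : Edge G → Fin (V G) → Set
  IsEnd e x = end₁ e ≡ x ⊎ end₂ e ≡ x

  ShareEnd⇒common-end : ∀ {e f : Edge G} → ShareEnd e f → ∃ λ x → IsEnd e x × IsEnd f x
  ShareEnd⇒common-end (inj₁ p)               = _ , inj₁ p , inj₁ refl
  ShareEnd⇒common-end (inj₂ (inj₁ p))        = _ , inj₁ p , inj₂ refl
  ShareEnd⇒common-end (inj₂ (inj₂ (inj₁ p))) = _ , inj₂ p , inj₁ refl
  ShareEnd⇒common-end (inj₂ (inj₂ (inj₂ p))) = _ , inj₂ p , inj₂ refl

  common-end⇒ShareEnd : ∀ {e f : Edge G} {x} → IsEnd e x → IsEnd f x → ShareEnd e f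
  common-end⇒ShareEnd (inj₁ p) (inj₁ q) = inj₁ (trans p (sym q))
  common-end⇒ShareEnd (inj₁ p) (inj₂ q) = inj₂ (inj₁ (trans p (sym q)))
  common-end⇒ShareEnd (inj₂ p) (inj₁ q) = inj₂ (inj₂ (inj₁ (trans p (sym q))))
  common-end⇒ShareEnd (inj₂ p) (inj₂ q) = inj₂ (inj₂ (inj₂ (trans p (sym q))))

  ShareEnd-sym : ∀ {e f : Edge G} → ShareEnd e f → ShareEnd f e
  ShareEnd-sym {e} {f} sh with ShareEnd⇒common-end {e} {f} sh
  ... | _ , e-end , f-end = common-end⇒ShareEnd {f} {e} f-end e-end

  edge-ext-unordered : ∀ {e f : Edge G} → SamePair (end₁ e) (end₂ e) (end₁ f) (end₂ f) → e ≡ f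
  edge-ext-unordered {e} {f} (inj₁ same) = Edge-ext same
  edge-ext-unordered {e} {f} (inj₂ (p , q)) =
    ⊥-elim (FinP.<-asym (ordered e) (subst₂ Fin._<_ (sym q) (sym p) (ordered f)))

  edgeOf : ∀ u v → adj G u v ≡ true → Edge G
  edgeOf u v uv with FinP.<-cmp u v
  ... | tri< u<v _ _ = edge u v u<v uv
  ... | tri≈ _ refl _ = contradiction (trans (sym (irrefl G u)) uv) λ ()
  ... | tri> _ _ v<u = edge v u v<u (trans (Graph.sym G v u) uv)

  edgeOf-ends : ∀ u v uv → SamePair (end₁ (edgeOf u v uv)) (end₂ (edgeOf u v uv)) u v
  edgeOf-ends u v uv with FinP.<-cmp u v
  ... | tri< _ _ _    = inj₁ (refl , refl)
  ... | tri≈ _ refl _ = contradiction (trans (sym (irrefl G u)) uv) λ ()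
  ... | tri> _ _ _    = inj₂ (refl , refl)

-- The edge colouring game on an arbitrary graph

module _ {G : Graph} {k : ℕ} where

  update-same : ∀ (c : Colouring G k) {e a f} → SameEnds f e → update c e a f ≡ just a
  update-same c {e} {a} {f} (p , q)
    rewrite dec-true (end₁ f FinP.≟ end₁ e) p | dec-true (end₂ f FinP.≟ end₂ e) q = refl

  update-other : ∀ (c : Colouring G k) {e a f} → ¬ SameEnds f e → update c e a f ≡ c f
  update-other c {e} {a} {f} f≉e with end₁ f FinP.≟ end₁ e | end₂ f FinP.≟ end₂ e
  ... | yes p | yes q = ⊥-elim (f≉e (p , q))
  ... | yes _ | no _  = refl
  ... | no _  | _     = refl

  legal-keeps : ∀ {c : Colouring G k} {e a f γ} → Legal c e a → c f ≡ just γ → update c e a f ≡ just γ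
  legal-keeps {c} {e} {a} {f} (ce , _) cf with same-ends? f e
  ... | yes f≈e = contradiction (trans (sym ce) (trans (cong c (sym (Edge-ext f≈e))) cf)) λ ()
  ... | no f≉e  = trans (update-other c {e} {a} f≉e) cf

  legal-no-clash : ∀ {c : Colouring G k} {e a f g α} → Legal c e a → SameEnds f e → ¬ SameEnds g e →
                   ShareEnd f g → update c e a f ≡ just α → update c e a g ≢ just α
  legal-no-clash {c} {e} {a} {f} {g} {α} (_ , e-free) f≈e g≉e sh cf cg =
    e-free g (subst (λ x → ShareEnd {G} x g) (Edge-ext {e = f} {f = e} f≈e) sh) (begin
      c g              ≡⟨ update-other c {e} {a} g≉e ⟨
      update c e a g   ≡⟨ cg ⟩
      just α           ≡⟨ trans (sym cf) (update-same c {e} {a} f≈e) ⟩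
      just a           ∎)
    where open ≡-Reasoning

  Proper : Colouring G k → Set
  Proper c = ∀ {e f α} → DistinctEdges e f → ShareEnd e f → c e ≡ just α → c f ≢ just α

  proper-update : ∀ {c e a} → Proper c → Legal c e a → Proper (update c e a)
  proper-update {c} {e} {a} P l {f} {g} f≠g sh cf cg with same-ends? f e | same-ends? g e
  ... | yes f≈e | yes g≈e =
    f≠g (trans (proj₁ f≈e) (sym (proj₁ g≈e)) , trans (proj₂ f≈e) (sym (proj₂ g≈e)))
  ... | yes f≈e | no g≉e  = legal-no-clash l f≈e g≉e sh cf cg
  ... | no f≉e  | yes g≈e = legal-no-clash l g≈e f≉e (ShareEnd-sym {e = f} {f = g} sh) cg cf
  ... | no f≉e  | no g≉e  =
    P f≠g sh (trans (sym (update-other c {e} {a} f≉e)) cf) (trans (sym (update-other c {e} {a} g≉e)) cg)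

  proper-complete⇒clique≤ : ∀ {c : Colouring G k} {es} → Proper c → Complete c → IsLineClique G es →
                            length es ≤ k
  proper-complete⇒clique≤ {c} {es} P done clique =
    subst (_≤ k) (length-map colour es) (unique-length≤ (AllPairsₚ.map⁺ (AllPairs.map distinct clique)))
    where
    colour : Edge G → Fin k
    colour e = proj₁ (done e)

    distinct : ∀ {e f} → DistinctEdges e f × ShareEnd e f → colour e ≢ colour f
    distinct {e} {f} (e≠f , sh) same = P e≠f sh (proj₂ (done e)) (trans (proj₂ (done f)) (cong just (sym same)))

  module _ {es : List (Edge G)} (clique : IsLineClique G es) where
    mutual
      bob-clique≤ : ∀ {c} → Proper c → BobTurn c → length es ≤ k
      bob-clique≤ P (bob-done done)              = proper-complete⇒clique≤ P done clique
      bob-clique≤ P (bob-move (e , a , l) alice) = alice-clique≤ (proper-update P l) (alice e a l)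

      alice-clique≤ : ∀ {c} → Proper c → AliceTurn c → length es ≤ k
      alice-clique≤ P (alice-done done)       = proper-complete⇒clique≤ P done clique
      alice-clique≤ P (alice-move e a l bob) = bob-clique≤ (proper-update P l) bob

  clique⇒¬AliceWins : ∀ {es} → IsLineClique G es → k < length es → ¬ AliceWinsB G k
  clique⇒¬AliceWins clique k<es win = ℕP.<⇒≱ k<es (bob-clique≤ clique (λ _ _ ()) win)

  Extends : Colouring G k → Colouring G k → Set
  Extends d c = ∀ {f γ} → c f ≡ just γ → d f ≡ just γ

  holes : Colouring G k → List (Edge G) → ℕ
  holes c []       = 0
  holes c (f ∷ es) with c f
  ... | just _  = holes c es
  ... | nothing = suc (holes c es)

  holes-≤ : ∀ {c d} → Extends d c → ∀ es → holes d es ≤ holes c es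
  holes-≤ d⊒c []       = z≤n
  holes-≤ {c} {d} d⊒c (f ∷ es) with c f in cf | d f in df
  ... | just _  | just _  = holes-≤ d⊒c es
  ... | just _  | nothing = contradiction (trans (sym df) (d⊒c cf)) λ ()
  ... | nothing | just _  = ℕP.m≤n⇒m≤1+n (holes-≤ d⊒c es)
  ... | nothing | nothing = s≤s (holes-≤ d⊒c es)

  holes-< : ∀ {c d f γ es} → Extends d c → f ∈ es → c f ≡ nothing → d f ≡ just γ →
            holes d es < holes c es
  holes-< {c} {d} {es = f ∷ es} d⊒c (here refl) cf df with c f | d f
  ... | nothing | just _ = s≤s (holes-≤ d⊒c es)
  ... | just _  | _      = contradiction cf λ ()
  ... | nothing | nothing = contradiction df λ ()
  holes-< {c} {d} {es = g ∷ es} d⊒c (there f∈es) cf df with c g in cg | d g in dg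
  ... | just _  | just _  = holes-< d⊒c f∈es cf df
  ... | just _  | nothing = contradiction (trans (sym dg) (d⊒c cg)) λ ()
  ... | nothing | just _  = ℕP.m≤n⇒m≤1+n (holes-< d⊒c f∈es cf df)
  ... | nothing | nothing = s≤s (holes-< d⊒c f∈es cf df)

  legal-holes< : ∀ {c e a es} → Legal c e a → e ∈ es → holes (update c e a) es < holes c es
  legal-holes< {c} {e} l e∈es = holes-< (legal-keeps l) e∈es (proj₁ l) (update-same c {e} (refl , refl))

  hole-or-coloured : ∀ (c : Colouring G k) es →
                     (∃ λ e → c e ≡ nothing) ⊎ All (λ f → ∃ λ γ → c f ≡ just γ) es
  hole-or-coloured c []       = inj₂ []
  hole-or-coloured c (f ∷ es) with c f in cf | hole-or-coloured c es
  ... | nothing | _             = inj₁ (f , cf)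
  ... | just γ  | inj₁ hole     = inj₁ hole
  ... | just γ  | inj₂ coloured = inj₂ ((γ , cf) ∷ coloured)

  module _ {es : List (Edge G)} (all∈ : ∀ e → e ∈ es) (Inv : Colouring G k → Set)
           (Inv-update : ∀ {c e a} → Legal c e a → Inv c → Inv (update c e a))
           (Inv-playable : ∀ {c e} → Inv c → c e ≡ nothing → ∃ λ a → Legal c e a) where

    mutual
      invariant⇒BobTurn′ : ∀ {c} → Inv c → Acc _<_ (holes c es) → BobTurn c
      invariant⇒BobTurn′ {c} I (acc smaller) with hole-or-coloured c es
      ... | inj₂ coloured  = bob-done λ e → All.lookup coloured (all∈ e)
      ... | inj₁ (e , ce) = bob-move (e , Inv-playable I ce) λ f a l →
        invariant⇒AliceTurn′ (Inv-update l I) (smaller (legal-holes< l (all∈ f)))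

      invariant⇒AliceTurn′ : ∀ {c} → Inv c → Acc _<_ (holes c es) → AliceTurn c
      invariant⇒AliceTurn′ {c} I (acc smaller) with hole-or-coloured c es
      ... | inj₂ coloured  = alice-done λ e → All.lookup coloured (all∈ e)
      ... | inj₁ (e , ce) with Inv-playable I ce
      ...   | a , l = alice-move e a l (invariant⇒BobTurn′ (Inv-update l I) (smaller (legal-holes< l (all∈ e))))

    invariant⇒BobTurn : ∀ {c} → Inv c → BobTurn c
    invariant⇒BobTurn I = invariant⇒BobTurn′ I (<-wellFounded _)

    invariant⇒AliceTurn : ∀ {c} → Inv c → AliceTurn c
    invariant⇒AliceTurn I = invariant⇒AliceTurn′ I (<-wellFounded _)

-- The (m,n)-amaryllis

data Side : Set where
  left right : Side

opposite : Side → Side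
opposite left  = right
opposite right = left

same-or-opposite : (s t : Side) → t ≡ s ⊎ t ≡ opposite s
same-or-opposite left  left  = inj₁ refl
same-or-opposite left  right = inj₂ refl
same-or-opposite right left  = inj₂ refl
same-or-opposite right right = inj₁ refl

-- Edges of the (m,n)-amaryllis: wv, vc₁ = vc left, vc₂ = vc right, c₁c₂ = cc, wxᵢ and vyⱼ.
data AmE (m n : ℕ) : Set where
  wv cc : AmE m n
  vc    : Side → AmE m n
  wx    : Fin m → AmE m n
  vy    : Fin n → AmE m n

_≉_ : ℕ → ℕ → Set
x ≉ y = False (x ℕ.≟ y)

≉⇒≢ : ∀ x y → x ≉ y → x ≢ y
≉⇒≢ x y = toWitnessFalse {a? = x ℕ.≟ y}

module _ {m n : ℕ} where

  ac : Side → AmV m n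
  ac left  = ac₁
  ac right = ac₂

  ∂₁ ∂₂ : AmE m n → AmV m n
  ∂₁ wv     = aw
  ∂₁ cc     = ac₁
  ∂₁ (vc s) = av
  ∂₁ (wx i) = aw
  ∂₁ (vy j) = av
  ∂₂ wv     = av
  ∂₂ cc     = ac₂
  ∂₂ (vc s) = ac s
  ∂₂ (wx i) = ax i
  ∂₂ (vy j) = ay j

  Incident : AmE m n → AmV m n → Set
  Incident a p = ∂₁ a ≡ p ⊎ ∂₂ a ≡ p

  data Adj (a b : AmE m n) : Set where
    meet : ∀ p → Incident a p → Incident b p → Adj a b

  Adj-refl : ∀ {a} → Adj a a
  Adj-refl {a} = meet (∂₁ a) (inj₁ refl) (inj₁ refl)

  Adj-sym : ∀ {a b} → Adj a b → Adj b a
  Adj-sym (meet p a∋p b∋p) = meet p b∋p a∋p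

  -- [apart] refutes adjacency by comparing the kinds of the ends.  kind₂ computes the kind of ∂₂ on the edge
  -- itself, so that it also reduces for vc s with an unknown side s.
  kind : AmV m n → ℕ
  kind av      = 0
  kind aw      = 1
  kind ac₁     = 2
  kind ac₂     = 2
  kind (ax _)  = 3
  kind (ay _)  = 4

  kind₁ kind₂ : AmE m n → ℕ
  kind₁ a = kind (∂₁ a)
  kind₂ wv     = 0
  kind₂ cc     = 2
  kind₂ (vc _) = 2
  kind₂ (wx _) = 3
  kind₂ (vy _) = 4

  incident-kind : ∀ {a p} → Incident a p → kind₁ a ≡ kind p ⊎ kind₂ a ≡ kind p
  incident-kind (inj₁ refl) = inj₁ refl
  incident-kind {wv}         (inj₂ refl) = inj₂ refl
  incident-kind {cc}         (inj₂ refl) = inj₂ refl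
  incident-kind {vc left}    (inj₂ refl) = inj₂ refl
  incident-kind {vc right}   (inj₂ refl) = inj₂ refl
  incident-kind {wx _}       (inj₂ refl) = inj₂ refl
  incident-kind {vy _}       (inj₂ refl) = inj₂ refl

  apart : ∀ {a b} {{_ : kind₁ a ≉ kind₁ b}} {{_ : kind₁ a ≉ kind₂ b}} {{_ : kind₂ a ≉ kind₁ b}}
          {{_ : kind₂ a ≉ kind₂ b}} → ¬ Adj a b
  apart {a} {b} {{d₁₁}} {{d₁₂}} {{d₂₁}} {{d₂₂}} (meet p a∋p b∋p)
    with incident-kind a∋p | incident-kind b∋p
  ... | inj₁ a₁ | inj₁ b₁ = ≉⇒≢ (kind₁ a) (kind₁ b) d₁₁ (trans a₁ (sym b₁))
  ... | inj₁ a₁ | inj₂ b₂ = ≉⇒≢ (kind₁ a) (kind₂ b) d₁₂ (trans a₁ (sym b₂))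
  ... | inj₂ a₂ | inj₁ b₁ = ≉⇒≢ (kind₂ a) (kind₁ b) d₂₁ (trans a₂ (sym b₁))
  ... | inj₂ a₂ | inj₂ b₂ = ≉⇒≢ (kind₂ a) (kind₂ b) d₂₂ (trans a₂ (sym b₂))

  v-star : Fin (3 + n) → AmE m n
  v-star Fin.zero                            = wv
  v-star (Fin.suc Fin.zero)                  = vc left
  v-star (Fin.suc (Fin.suc Fin.zero))        = vc right
  v-star (Fin.suc (Fin.suc (Fin.suc j)))     = vy j

  v-index : AmE m n → Fin (3 + n)
  v-index (vc left)  = Fin.suc Fin.zero
  v-index (vc right) = Fin.suc (Fin.suc Fin.zero)
  v-index (vy j)     = Fin.suc (Fin.suc (Fin.suc j))
  v-index _          = Fin.zero

  v-index-v-star : ∀ i → v-index (v-star i) ≡ i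
  v-index-v-star Fin.zero                        = refl
  v-index-v-star (Fin.suc Fin.zero)              = refl
  v-index-v-star (Fin.suc (Fin.suc Fin.zero))    = refl
  v-index-v-star (Fin.suc (Fin.suc (Fin.suc j))) = refl

  v-star-injective : ∀ {i j} → v-star i ≡ v-star j → i ≡ j
  v-star-injective {i} {j} eq = trans (sym (v-index-v-star i)) (trans (cong v-index eq) (v-index-v-star j))

  v-star-at-v : ∀ i → Incident (v-star i) av
  v-star-at-v Fin.zero                        = inj₂ refl
  v-star-at-v (Fin.suc Fin.zero)              = inj₁ refl
  v-star-at-v (Fin.suc (Fin.suc Fin.zero))    = inj₁ refl
  v-star-at-v (Fin.suc (Fin.suc (Fin.suc j))) = inj₁ refl

  w-star : Fin (1 + m) → AmE m n
  w-star Fin.zero    = wv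
  w-star (Fin.suc i) = wx i

  w-index : AmE m n → Fin (1 + m)
  w-index (wx i) = Fin.suc i
  w-index _      = Fin.zero

  w-index-w-star : ∀ i → w-index (w-star i) ≡ i
  w-index-w-star Fin.zero    = refl
  w-index-w-star (Fin.suc i) = refl

  w-star-injective : ∀ {i j} → w-star i ≡ w-star j → i ≡ j
  w-star-injective {i} {j} eq = trans (sym (w-index-w-star i)) (trans (cong w-index eq) (w-index-w-star j))

  w-star-at-w : ∀ i → Incident (w-star i) aw
  w-star-at-w Fin.zero    = inj₁ refl
  w-star-at-w (Fin.suc i) = inj₁ refl

  star : AmV m n → List (AmE m n)
  star av     = tabulate v-star
  star aw     = tabulate w-star
  star ac₁    = cc ∷ vc left ∷ []
  star ac₂    = cc ∷ vc right ∷ []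
  star (ax i) = wx i ∷ []
  star (ay j) = vy j ∷ []

  v-star∈ : ∀ i → v-star i ∈ star av
  v-star∈ i = ∈-tabulate⁺ {f = v-star} i

  w-star∈ : ∀ i → w-star i ∈ star aw
  w-star∈ i = ∈-tabulate⁺ {f = w-star} i

  ∈-star : ∀ {a p} → Incident a p → a ∈ star p
  ∈-star {wv}       (inj₁ refl) = w-star∈ Fin.zero
  ∈-star {wv}       (inj₂ refl) = v-star∈ Fin.zero
  ∈-star {cc}       (inj₁ refl) = here refl
  ∈-star {cc}       (inj₂ refl) = here refl
  ∈-star {vc left}  (inj₁ refl) = v-star∈ (Fin.suc Fin.zero)
  ∈-star {vc right} (inj₁ refl) = v-star∈ (Fin.suc (Fin.suc Fin.zero))
  ∈-star {vc left}  (inj₂ refl) = there (here refl)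
  ∈-star {vc right} (inj₂ refl) = there (here refl)
  ∈-star {wx i}     (inj₁ refl) = w-star∈ (Fin.suc i)
  ∈-star {wx i}     (inj₂ refl) = here refl
  ∈-star {vy j}     (inj₁ refl) = v-star∈ (Fin.suc (Fin.suc (Fin.suc j)))
  ∈-star {vy j}     (inj₂ refl) = here refl

  length-v-star : length (star av) ≡ 3 + n
  length-v-star = length-tabulate v-star

  length-w-star : length (star aw) ≡ 1 + m
  length-w-star = length-tabulate w-star

  nbhd : AmE m n → List (AmE m n)
  nbhd wv     = star aw ++ star av
  nbhd cc     = vc left ∷ cc ∷ vc right ∷ []
  nbhd (vc s) = cc ∷ star av
  nbhd (wx i) = star aw
  nbhd (vy j) = star av

  Adj⇒∈nbhd : ∀ {a b} → Adj a b → b ∈ nbhd a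
  Adj⇒∈nbhd {wv}   (meet _ (inj₁ refl) b∋w) = ∈-++⁺ˡ (∈-star b∋w)
  Adj⇒∈nbhd {wv}   (meet _ (inj₂ refl) b∋v) = ∈-++⁺ʳ (star aw) (∈-star b∋v)
  Adj⇒∈nbhd {cc}   (meet _ (inj₁ refl) b∋c) with ∈-star b∋c
  ... | here refl         = there (here refl)
  ... | there (here refl) = here refl
  Adj⇒∈nbhd {cc}   (meet _ (inj₂ refl) b∋c) with ∈-star b∋c
  ... | here refl         = there (here refl)
  ... | there (here refl) = there (there (here refl))
  Adj⇒∈nbhd {vc s} (meet _ (inj₁ refl) b∋v) = there (∈-star b∋v)
  Adj⇒∈nbhd {vc left}  (meet _ (inj₂ refl) b∋c) with ∈-star b∋c
  ... | here refl         = here refl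
  ... | there (here refl) = there (∈-star (inj₁ refl))
  Adj⇒∈nbhd {vc right} (meet _ (inj₂ refl) b∋c) with ∈-star b∋c
  ... | here refl         = here refl
  ... | there (here refl) = there (∈-star (inj₁ refl))
  Adj⇒∈nbhd {wx i} (meet _ (inj₁ refl) b∋w) = ∈-star b∋w
  Adj⇒∈nbhd {wx i} (meet _ (inj₂ refl) b∋x) with ∈-star b∋x
  ... | here refl = ∈-star (inj₁ refl)
  Adj⇒∈nbhd {vy j} (meet _ (inj₁ refl) b∋v) = ∈-star b∋v
  Adj⇒∈nbhd {vy j} (meet _ (inj₂ refl) b∋y) with ∈-star b∋y
  ... | here refl = ∈-star (inj₁ refl)

  AmClique : List (AmE m n) → Set
  AmClique = AllPairs (λ a b → a ≢ b × Adj a b)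

  clique-Adj : ∀ {as a b} → AmClique as → a ∈ as → b ∈ as → Adj a b
  clique-Adj (_ ∷ _)  (here refl) (here refl) = Adj-refl
  clique-Adj (r ∷ _)  (here refl) (there b∈) = proj₂ (All.lookup r b∈)
  clique-Adj (r ∷ _)  (there a∈)  (here refl) = Adj-sym (proj₂ (All.lookup r a∈))
  clique-Adj (_ ∷ rs) (there a∈)  (there b∈) = clique-Adj rs a∈ b∈

  clique⊆nbhd : ∀ {as a} → AmClique as → a ∈ as → as ⊆ nbhd a
  clique⊆nbhd clique a∈ b∈ = Adj⇒∈nbhd (clique-Adj clique a∈ b∈)

  is-cc? : (a : AmE m n) → Dec (cc ≡ a)
  is-cc? cc     = yes refl
  is-cc? wv     = no λ ()
  is-cc? (vc _) = no λ ()
  is-cc? (wx _) = no λ ()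
  is-cc? (vy _) = no λ ()

  is-wx? : (a : AmE m n) → Dec (∃ λ i → wx i ≡ a)
  is-wx? (wx i) = yes (i , refl)
  is-wx? wv     = no λ ()
  is-wx? cc     = no λ ()
  is-wx? (vc _) = no λ ()
  is-wx? (vy _) = no λ ()

  at-v : ∀ {a} → cc ≢ a → (∀ i → wx i ≢ a) → Incident a av
  at-v {wv}   _    _   = inj₂ refl
  at-v {cc}   ¬cc  _   = ⊥-elim (¬cc refl)
  at-v {vc _} _    _   = inj₁ refl
  at-v {wx i} _    ¬wx = ⊥-elim (¬wx i refl)
  at-v {vy _} _    _   = inj₁ refl

  clique-⊆⇒length≤ : ∀ {as bs ω} → AmClique as → as ⊆ bs → length bs ≡ ω → length as ≤ ω
  clique-⊆⇒length≤ clique as⊆bs refl = unique-⊆⇒length≤ (AllPairs.map proj₁ clique) as⊆bs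

  -- A clique lies in the triangle if it contains c₁c₂, in the star of w if it contains some wxᵢ,
  -- and in the star of v otherwise.
  clique-length≤ : ∀ {ω as} → 3 ≤ ω → 1 + m ≤ ω → 3 + n ≤ ω → AmClique as → length as ≤ ω
  clique-length≤ {ω} {as} 3≤ω w≤ω v≤ω clique with Any.any? is-cc? as | Any.any? is-wx? as
  ... | yes cc∈ | _ = ℕP.≤-trans (clique-⊆⇒length≤ clique (clique⊆nbhd clique cc∈) refl) 3≤ω
  ... | no _ | yes some-wx with find {P = λ a → ∃ λ i → wx i ≡ a} some-wx
  ...   | _ , x∈ , i , refl =
    ℕP.≤-trans (clique-⊆⇒length≤ clique (clique⊆nbhd clique x∈) length-w-star) w≤ω
  clique-length≤ {ω} {as} 3≤ω w≤ω v≤ω clique | no no-cc | no no-wx =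
    ℕP.≤-trans (clique-⊆⇒length≤ clique at-v∈ length-v-star) v≤ω
    where
    at-v∈ : as ⊆ star av
    at-v∈ b∈ = ∈-star (at-v (λ cc≡b → no-cc (Any.map (trans cc≡b) b∈))
                            (λ i wx≡b → no-wx (Any.map (λ b≡x → i , trans wx≡b b≡x) b∈)))

  ∂-adjacent : ∀ a → amAdj (∂₁ a) (∂₂ a) ≡ true
  ∂-adjacent wv         = refl
  ∂-adjacent cc         = refl
  ∂-adjacent (vc left)  = refl
  ∂-adjacent (vc right) = refl
  ∂-adjacent (wx _)     = refl
  ∂-adjacent (vy _)     = refl

  edgeBetween : AmV m n → AmV m n → Maybe (AmE m n)
  edgeBetween aw      av      = just wv
  edgeBetween av      aw      = just wv
  edgeBetween ac₁     ac₂     = just cc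
  edgeBetween ac₂     ac₁     = just cc
  edgeBetween av      ac₁     = just (vc left)
  edgeBetween ac₁     av      = just (vc left)
  edgeBetween av      ac₂     = just (vc right)
  edgeBetween ac₂     av      = just (vc right)
  edgeBetween aw      (ax i)  = just (wx i)
  edgeBetween (ax i)  aw      = just (wx i)
  edgeBetween av      (ay j)  = just (vy j)
  edgeBetween (ay j)  av      = just (vy j)
  edgeBetween _       _       = nothing

  edgeBetween-∂ : ∀ a → edgeBetween (∂₁ a) (∂₂ a) ≡ just a × edgeBetween (∂₂ a) (∂₁ a) ≡ just a
  edgeBetween-∂ wv         = refl , refl
  edgeBetween-∂ cc         = refl , refl
  edgeBetween-∂ (vc left)  = refl , refl
  edgeBetween-∂ (vc right) = refl , refl
  edgeBetween-∂ (wx _)     = refl , refl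
  edgeBetween-∂ (vy _)     = refl , refl

  Joins : AmE m n → AmV m n → AmV m n → Set
  Joins a = SamePair (∂₁ a) (∂₂ a)

  joins-injective : ∀ {a b} → Joins a (∂₁ b) (∂₂ b) → a ≡ b
  joins-injective {a} {b} joins = just-injective (trans (sym (between-a joins)) (proj₁ (edgeBetween-∂ b)))
    where
    between-a : ∀ {p q} → Joins a p q → edgeBetween p q ≡ just a
    between-a (inj₁ (refl , refl)) = proj₁ (edgeBetween-∂ a)
    between-a (inj₂ (refl , refl)) = proj₂ (edgeBetween-∂ a)

  amAdj⇒joined : ∀ p q → amAdj p q ≡ true → ∃ λ a → Joins a p q
  amAdj⇒joined av      av      ()
  amAdj⇒joined av      aw      _  = wv , inj₂ (refl , refl)
  amAdj⇒joined av      ac₁     _  = vc left , inj₁ (refl , refl)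
  amAdj⇒joined av      ac₂     _  = vc right , inj₁ (refl , refl)
  amAdj⇒joined av      (ax _)  ()
  amAdj⇒joined av      (ay j)  _  = vy j , inj₁ (refl , refl)
  amAdj⇒joined aw      av      _  = wv , inj₁ (refl , refl)
  amAdj⇒joined aw      aw      ()
  amAdj⇒joined aw      ac₁     ()
  amAdj⇒joined aw      ac₂     ()
  amAdj⇒joined aw      (ax i)  _  = wx i , inj₁ (refl , refl)
  amAdj⇒joined aw      (ay _)  ()
  amAdj⇒joined ac₁     av      _  = vc left , inj₂ (refl , refl)
  amAdj⇒joined ac₁     aw      ()
  amAdj⇒joined ac₁     ac₁     ()
  amAdj⇒joined ac₁     ac₂     _  = cc , inj₁ (refl , refl)
  amAdj⇒joined ac₁     (ax _)  ()
  amAdj⇒joined ac₁     (ay _)  ()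
  amAdj⇒joined ac₂     av      _  = vc right , inj₂ (refl , refl)
  amAdj⇒joined ac₂     aw      ()
  amAdj⇒joined ac₂     ac₁     _  = cc , inj₂ (refl , refl)
  amAdj⇒joined ac₂     ac₂     ()
  amAdj⇒joined ac₂     (ax _)  ()
  amAdj⇒joined ac₂     (ay _)  ()
  amAdj⇒joined (ax _)  av      ()
  amAdj⇒joined (ax i)  aw      _  = wx i , inj₂ (refl , refl)
  amAdj⇒joined (ax _)  ac₁     ()
  amAdj⇒joined (ax _)  ac₂     ()
  amAdj⇒joined (ax _)  (ax _)  ()
  amAdj⇒joined (ax _)  (ay _)  ()
  amAdj⇒joined (ay j)  av      _  = vy j , inj₂ (refl , refl)
  amAdj⇒joined (ay _)  aw      ()
  amAdj⇒joined (ay _)  ac₁     ()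
  amAdj⇒joined (ay _)  ac₂     ()
  amAdj⇒joined (ay _)  (ax _)  ()
  amAdj⇒joined (ay _)  (ay _)  ()

  allAmE : List (AmE m n)
  allAmE = cc ∷ star aw ++ star av

  ∈-allAmE : ∀ a → a ∈ allAmE
  ∈-allAmE wv     = there (∈-++⁺ˡ (∈-star (inj₁ refl)))
  ∈-allAmE cc     = here refl
  ∈-allAmE (vc _) = there (∈-++⁺ʳ (star aw) (∈-star (inj₁ refl)))
  ∈-allAmE (wx _) = there (∈-++⁺ˡ (∈-star (inj₁ refl)))
  ∈-allAmE (vy _) = there (∈-++⁺ʳ (star aw) (∈-star (inj₁ refl)))

  cc~vc : ∀ s → Adj cc (vc s)
  cc~vc left  = meet ac₁ (inj₁ refl) (inj₂ refl)
  cc~vc right = meet ac₂ (inj₂ refl) (inj₂ refl)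

  vc-opposite : ∀ s → vc {m} {n} (opposite s) ≢ vc s
  vc-opposite left  ()
  vc-opposite right ()

module Embedding {G : Graph} {m n : ℕ} (φ : AmV m n → Fin (V G))
                 (φ-injective : ∀ a b → φ a ≡ φ b → a ≡ b)
                 (φ-adj : ∀ a b → adj G (φ a) (φ b) ≡ amAdj a b)
                 (φ-covers : ∀ u v → adj G u v ≡ true → (∃[ a ] (φ a ≡ u)) × (∃[ b ] (φ b ≡ v))) where

  toE : AmE m n → Edge G
  toE a = edgeOf (φ (∂₁ a)) (φ (∂₂ a)) (trans (φ-adj (∂₁ a) (∂₂ a)) (∂-adjacent a))

  toE-ends : ∀ a → SamePair (end₁ (toE a)) (end₂ (toE a)) (φ (∂₁ a)) (φ (∂₂ a))
  toE-ends a = edgeOf-ends (φ (∂₁ a)) (φ (∂₂ a)) _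

  toE-injective : ∀ {a b} → SameEnds (toE a) (toE b) → a ≡ b
  toE-injective {a} {b} same = joins-injective (same-pair-injective (φ-injective _ _)
    (same-pair-trans (same-pair-sym (toE-ends a)) (same-pair-trans (inj₁ same) (toE-ends b))))

  edge-classified : ∀ e → ∃ λ a → toE a ≡ e
  edge-classified e with φ-covers (end₁ e) (end₂ e) (isEdge e)
  ... | (p , refl) , (q , refl) with amAdj⇒joined p q (trans (sym (φ-adj p q)) (isEdge e))
  ...   | a , joins = a , edge-ext-unordered (same-pair-trans (toE-ends a) (same-pair-map φ joins))

  fromE : Edge G → AmE m n
  fromE e = proj₁ (edge-classified e)

  toE-fromE : ∀ e → toE (fromE e) ≡ e
  toE-fromE e = proj₂ (edge-classified e)

  Incident⇒IsEnd : ∀ {a p} → Incident a p → IsEnd (toE a) (φ p)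
  Incident⇒IsEnd {a} a∋p with toE-ends a | a∋p
  ... | inj₁ (e₁ , _) | inj₁ refl = inj₁ e₁
  ... | inj₁ (_ , e₂) | inj₂ refl = inj₂ e₂
  ... | inj₂ (_ , e₂) | inj₁ refl = inj₂ e₂
  ... | inj₂ (e₁ , _) | inj₂ refl = inj₁ e₁

  IsEnd⇒Incident : ∀ {a x} → IsEnd (toE a) x → ∃ λ p → Incident a p × φ p ≡ x
  IsEnd⇒Incident {a} x-end with toE-ends a | x-end
  ... | inj₁ (e₁ , _) | inj₁ refl = ∂₁ a , inj₁ refl , sym e₁
  ... | inj₁ (_ , e₂) | inj₂ refl = ∂₂ a , inj₂ refl , sym e₂
  ... | inj₂ (e₁ , _) | inj₁ refl = ∂₂ a , inj₂ refl , sym e₁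
  ... | inj₂ (_ , e₂) | inj₂ refl = ∂₁ a , inj₁ refl , sym e₂

  Adj⇒ShareEnd : ∀ {a b} → Adj a b → ShareEnd (toE a) (toE b)
  Adj⇒ShareEnd {a} {b} (meet p a∋p b∋p) =
    common-end⇒ShareEnd {e = toE a} {f = toE b} (Incident⇒IsEnd a∋p) (Incident⇒IsEnd b∋p)

  ShareEnd⇒Adj : ∀ {a b} → ShareEnd (toE a) (toE b) → Adj a b
  ShareEnd⇒Adj {a} {b} sh with ShareEnd⇒common-end {e = toE a} {f = toE b} sh
  ... | x , a-end , b-end with IsEnd⇒Incident a-end | IsEnd⇒Incident b-end
  ...   | p , a∋p , refl | q , b∋q , φq≡φp = meet p a∋p (subst (Incident _) (φ-injective q p φq≡φp) b∋q)

-- Alice's strategies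

module Play {G : Graph} {m n : ℕ} (φ : AmV m n → Fin (V G))
            (φ-injective : ∀ a b → φ a ≡ φ b → a ≡ b)
            (φ-adj : ∀ a b → adj G (φ a) (φ b) ≡ amAdj a b)
            (φ-covers : ∀ u v → adj G u v ≡ true → (∃[ a ] (φ a ≡ u)) × (∃[ b ] (φ b ≡ v)))
            (k : ℕ) where

  open Embedding {G} φ φ-injective φ-adj φ-covers

  Col : Set
  Col = Colouring G k

  legal-by-Adj : ∀ {c : Col} {a α} → c (toE a) ≡ nothing → (∀ {b} → Adj a b → c (toE b) ≢ just α) →
                 Legal c (toE a) α
  legal-by-Adj {c} {a} {α} ca avoid = ca , λ f sh → subst (λ f → c f ≢ just α) (toE-fromE f)
    (avoid (ShareEnd⇒Adj (subst (ShareEnd (toE a)) (sym (toE-fromE f)) sh)))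

  legal-avoids-Adj : ∀ {c : Col} {a α b} → Legal c (toE a) α → Adj a b → c (toE b) ≢ just α
  legal-avoids-Adj (_ , avoid) ab = avoid _ (Adj⇒ShareEnd ab)

  colours : Col → List (AmE m n) → List (Fin k)
  colours c = mapMaybe (c ∘ toE)

  ∈-colours : ∀ {c : Col} {b γ bs} → b ∈ bs → c (toE b) ≡ just γ → γ ∈ colours c bs
  ∈-colours {c} (here refl) cb rewrite cb = here refl
  ∈-colours {c} {bs = b′ ∷ _} (there b∈) cb with c (toE b′)
  ... | just _  = there (∈-colours {c} b∈ cb)
  ... | nothing = ∈-colours {c} b∈ cb

  length-colours< : ∀ {c : Col} {a bs} → a ∈ bs → c (toE a) ≡ nothing → length (colours c bs) < length bs
  length-colours< {c} {bs = _ ∷ bs} (here refl) ca rewrite ca = s≤s (length-mapMaybe (c ∘ toE) bs)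
  length-colours< {c} {bs = b ∷ _} (there a∈) ca with c (toE b)
  ... | just _  = s≤s (length-colours< {c} a∈ ca)
  ... | nothing = ℕP.m≤n⇒m≤1+n (length-colours< {c} a∈ ca)

  playable-avoiding : ∀ {c : Col} {a} (C : List (Fin k)) → length C < k →
                      (∀ {b γ} → Adj a b → c (toE b) ≡ just γ → γ ∈ C) →
                      c (toE a) ≡ nothing → ∃ λ α → Legal c (toE a) α
  playable-avoiding {c} C C<k used ca with ∃∉ C C<k
  ... | α , α∉C = α , legal-by-Adj {c} ca λ ab cb → α∉C (used ab cb)

  playable-nbhd : ∀ {c : Col} {a} → length (nbhd a) ≤ k → c (toE a) ≡ nothing →
                  ∃ λ α → Legal c (toE a) α
  playable-nbhd {c} {a} nbhd≤k ca = playable-avoiding {c} {a} (colours c (nbhd a))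
    (ℕP.<-≤-trans (length-colours< {c} {a} (Adj⇒∈nbhd Adj-refl) ca) nbhd≤k)
    (λ ab cb → ∈-colours {c} (Adj⇒∈nbhd ab) cb) ca

  Assignment : Set
  Assignment = List (AmE m n × Fin k)

  record Exactly (c : Col) (s : Assignment) : Set where
    field
      shows : ∀ {a α} → (a , α) ∈ s → c (toE a) ≡ just α
      only  : ∀ {a α} → c (toE a) ≡ just α → (a , α) ∈ s
  open Exactly

  Exactly-empty : Exactly emptyCol []
  Exactly-empty = record { shows = λ () ; only = λ () }

  Exactly-update : ∀ {c s a α} → Exactly c s → Legal c (toE a) α →
                   Exactly (update c (toE a) α) ((a , α) ∷ s)
  Exactly-update {c} {s} {a} {α} E l = record { shows = shows′ ; only = only′ }
    where
    shows′ : ∀ {b β} → (b , β) ∈ (a , α) ∷ s → update c (toE a) α (toE b) ≡ just β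
    shows′ (here refl) = update-same c {toE a} (refl , refl)
    shows′ (there b∈s) = legal-keeps l (shows E b∈s)

    only′ : ∀ {b β} → update c (toE a) α (toE b) ≡ just β → (b , β) ∈ (a , α) ∷ s
    only′ {b} cb with same-ends? (toE b) (toE a)
    ... | yes b≈a with toE-injective b≈a
    ...   | refl = here (cong (b ,_) (just-injective (trans (sym cb) (update-same c {toE a} b≈a))))
    only′ {b} cb | no b≉a = there (only E (trans (sym (update-other c {toE a} {α} b≉a)) cb))

  Exactly-↭ : ∀ {c s t} → s ↭ t → Exactly c s → Exactly c t
  Exactly-↭ s↭t E = record
    { shows = λ a∈t → shows E (∈-resp-↭ (↭-sym s↭t) a∈t)
    ; only  = λ ca → ∈-resp-↭ s↭t (only E ca)
    }

  Fresh : AmE m n → Fin k → Assignment → Set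
  Fresh a α = All λ (b , β) → a ≢ b × (Adj a b → β ≢ α)

  fresh⇒legal : ∀ {c s a α} → Exactly c s → Fresh a α s → Legal c (toE a) α
  fresh⇒legal {c} {s} {a} {α} E fresh = legal-by-Adj {c} uncoloured λ {b} ab cb →
    proj₂ (All.lookup fresh (only E cb)) ab refl
    where
    uncoloured : c (toE a) ≡ nothing
    uncoloured with c (toE a) in ca
    ... | nothing = refl
    ... | just γ  = ⊥-elim (proj₁ (All.lookup fresh (only E ca)) refl)

  legal⇒fresh : ∀ {c s a α} → Exactly c s → Legal c (toE a) α → Fresh a α s
  legal⇒fresh {c} {a = a} {α} E l = All.tabulate λ {(b , β)} b∈s →
      (λ { refl → contradiction (trans (sym (proj₁ l)) (shows E b∈s)) λ () })
    , (λ ab β≡α → legal-avoids-Adj {c} l ab (trans (shows E b∈s) (cong just β≡α)))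

  AliceWinsFrom BobLosesFrom : Assignment → Set
  AliceWinsFrom s = ∀ {c} → Exactly c s → AliceTurn c
  BobLosesFrom s  = ∀ {c} → Exactly c s → BobTurn c

  alice-plays : ∀ {s} a α → Fresh a α s → BobLosesFrom ((a , α) ∷ s) → AliceWinsFrom s
  alice-plays a α fresh next {c} E = alice-move (toE a) α l (next (Exactly-update E l))
    where
    l : Legal c (toE a) α
    l = fresh⇒legal E fresh

  bob-plays : ∀ {s} → (∃₂ λ b β → Fresh b β s) →
              (∀ b β → Fresh b β s → AliceWinsFrom ((b , β) ∷ s)) → BobLosesFrom s
  bob-plays (b , β , fresh) respond {c} E = bob-move (toE b , β , fresh⇒legal E fresh) λ e γ l →
    subst (λ e → AliceTurn (update c e γ)) (toE-fromE e)
          (answer (fromE e) γ (subst (λ e → Legal c e γ) (sym (toE-fromE e)) l))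
    where
    answer : ∀ a γ → Legal c (toE a) γ → AliceTurn (update c (toE a) γ)
    answer a γ l = respond a γ (legal⇒fresh E l) (Exactly-update E l)

  record Invariant : Set₁ where
    field
      Holds     : Col → Set
      preserved : ∀ {c e α} → Legal c e α → Holds c → Holds (update c e α)
      playable  : ∀ {c a} → Holds c → c (toE a) ≡ nothing → ∃ λ α → Legal c (toE a) α

  ∈-all-edges : ∀ e → e ∈ map toE allAmE
  ∈-all-edges e = subst (_∈ map toE allAmE) (toE-fromE e) (∈-map⁺ toE (∈-allAmE (fromE e)))

  module _ (I : Invariant) where
    open Invariant I

    playable-edge : ∀ {c e} → Holds c → c e ≡ nothing → ∃ λ α → Legal c e α
    playable-edge {c} {e} H ce with playable H (trans (cong c (toE-fromE e)) ce)
    ... | α , l = α , subst (λ e → Legal c e α) (toE-fromE e) l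

    holds⇒AliceTurn : ∀ {c} → Holds c → AliceTurn c
    holds⇒AliceTurn = invariant⇒AliceTurn ∈-all-edges Holds preserved playable-edge

    holds⇒BobTurn : ∀ {c} → Holds c → BobTurn c
    holds⇒BobTurn = invariant⇒BobTurn ∈-all-edges Holds preserved playable-edge

  ColourOf : Col → AmE m n → Fin k → Set
  ColourOf c a α = c (toE a) ≡ just α

  Assigned : Assignment → AmE m n → Fin k → Set
  Assigned s a α = (a , α) ∈ s

  WvColoured : (AmE m n → Fin k → Set) → Set
  WvColoured R = ∃ (R wv)

  -- Once settled, an uncoloured vcᵢ sees at most n + 2 colours on its n + 3 neighbours.
  Settled : (AmE m n → Fin k → Set) → Set
  Settled R = WvColoured R
            × ((∃ λ γ → R cc γ × (R wv γ ⊎ ∃ λ j → R (vy j) γ))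
               ⊎ (∃ (R (vc left)) × ∃ (R (vc right))))

  Settled-map : ∀ {R R′ : AmE m n → Fin k → Set} → (∀ {a α} → R a α → R′ a α) → Settled R → Settled R′
  Settled-map f ((β , wvβ) , inj₁ (γ , ccγ , inj₁ wvγ)) =
    (β , f wvβ) , inj₁ (γ , f ccγ , inj₁ (f wvγ))
  Settled-map f ((β , wvβ) , inj₁ (γ , ccγ , inj₂ (j , yγ))) =
    (β , f wvβ) , inj₁ (γ , f ccγ , inj₂ (j , f yγ))
  Settled-map f ((β , wvβ) , inj₂ ((α , vc₁α) , (α′ , vc₂α′))) =
    (β , f wvβ) , inj₂ ((α , f vc₁α) , (α′ , f vc₂α′))

  coloured≢nothing : ∀ {x : Maybe (Fin k)} {α} → x ≡ just α → x ≢ nothing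
  coloured≢nothing refl ()

  playable-cc : ∀ {c : Col} → 3 ≤ k → c (toE cc) ≡ nothing → ∃ λ α → Legal c (toE cc) α
  playable-cc {c} = playable-nbhd {c} {cc}

  playable-wx : ∀ {c : Col} {i} → 1 + m ≤ k → c (toE (wx i)) ≡ nothing → ∃ λ α → Legal c (toE (wx i)) α
  playable-wx {c} {i} w≤k = playable-nbhd {c} {wx i} (subst (_≤ k) (sym length-w-star) w≤k)

  playable-vy : ∀ {c : Col} {j} → 3 + n ≤ k → c (toE (vy j)) ≡ nothing → ∃ λ α → Legal c (toE (vy j)) α
  playable-vy {c} {j} v≤k = playable-nbhd {c} {vy j} (subst (_≤ k) (sym length-v-star) v≤k)

  playable-vc : ∀ {c : Col} {s} → 4 + n ≤ k → c (toE (vc s)) ≡ nothing → ∃ λ α → Legal c (toE (vc s)) α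
  playable-vc {c} {s} v<k = playable-nbhd {c} {vc s} (subst (_≤ k) (sym (cong suc length-v-star)) v<k)

  -- Here c₁c₂, the neighbour of vc s off the star of v, repeats a colour of that star.
  playable-vc-settled : ∀ {c : Col} {s γ} → 3 + n ≤ k → ColourOf c cc γ →
                        (ColourOf c wv γ ⊎ ∃ λ j → ColourOf c (vy j) γ) →
                        c (toE (vc s)) ≡ nothing → ∃ λ α → Legal c (toE (vc s)) α
  playable-vc-settled {c} {s} {γ} v≤k ccγ at-v ca = playable-avoiding {c} {vc s} (colours c (star av))
    (ℕP.<-≤-trans (length-colours< {c} (∈-star (inj₁ refl)) ca) (subst (_≤ k) (sym length-v-star) v≤k))
    used ca
    where
    γ-at-v : (ColourOf c wv γ ⊎ ∃ λ j → ColourOf c (vy j) γ) → γ ∈ colours c (star av)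
    γ-at-v (inj₁ wvγ)      = ∈-colours {c} {wv} (∈-star (inj₂ refl)) wvγ
    γ-at-v (inj₂ (j , yγ)) = ∈-colours {c} {vy j} (∈-star (inj₁ refl)) yγ

    used : ∀ {b β} → Adj (vc s) b → c (toE b) ≡ just β → β ∈ colours c (star av)
    used ab cb with Adj⇒∈nbhd ab
    ... | here refl = subst (_∈ colours c (star av)) (just-injective (trans (sym ccγ) cb)) (γ-at-v at-v)
    ... | there b∈  = ∈-colours {c} b∈ cb

  wv-invariant : 4 + n ≤ k → 1 + m ≤ k → Invariant
  wv-invariant v<k w≤k = record
    { Holds     = λ c → WvColoured (ColourOf c)
    ; preserved = λ { l (β , wvβ) → β , legal-keeps {f = toE wv} l wvβ }
    ; playable  = playable
    }
    where
    playable : ∀ {c a} → WvColoured (ColourOf c) → c (toE a) ≡ nothing → ∃ λ α → Legal c (toE a) α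
    playable {a = wv}   (_ , wvβ) ca = ⊥-elim (coloured≢nothing wvβ ca)
    playable {a = cc}   _ ca = playable-cc (ℕP.≤-trans (s≤s (s≤s (s≤s z≤n))) v<k) ca
    playable {a = vc _} _ ca = playable-vc v<k ca
    playable {a = wx _} _ ca = playable-wx w≤k ca
    playable {a = vy _} _ ca = playable-vy (ℕP.≤-trans (ℕP.n≤1+n _) v<k) ca

  settled-invariant : 3 + n ≤ k → 1 + m ≤ k → Invariant
  settled-invariant v≤k w≤k = record
    { Holds     = λ c → Settled (ColourOf c)
    ; preserved = λ l → Settled-map (λ {a} {α} → legal-keeps {f = toE a} {γ = α} l)
    ; playable  = playable
    }
    where
    playable : ∀ {c a} → Settled (ColourOf c) → c (toE a) ≡ nothing → ∃ λ α → Legal c (toE a) α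
    playable {a = wv}   ((_ , wvβ) , _) ca = ⊥-elim (coloured≢nothing wvβ ca)
    playable {a = cc}   _ ca = playable-cc (ℕP.≤-trans (s≤s (s≤s (s≤s z≤n))) v≤k) ca
    playable {a = vc _} (_ , inj₁ (γ , ccγ , at-v)) ca = playable-vc-settled v≤k ccγ at-v ca
    playable {a = vc left}  (_ , inj₂ ((_ , vc₁α) , _)) ca = ⊥-elim (coloured≢nothing vc₁α ca)
    playable {a = vc right} (_ , inj₂ (_ , (_ , vc₂α))) ca = ⊥-elim (coloured≢nothing vc₂α ca)
    playable {a = wx _} _ ca = playable-wx w≤k ca
    playable {a = vy _} _ ca = playable-vy v≤k ca

  another-colour : 1 < k → (α : Fin k) → ∃ λ β → α ≢ β
  another-colour 1<k α with ∃∉ (α ∷ []) 1<k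
  ... | β , β∉ = β , λ α≡β → β∉ (here (sym α≡β))

  third-colour : 2 < k → (α β : Fin k) → ∃ λ γ → α ≢ γ × β ≢ γ
  third-colour 2<k α β with ∃∉ (α ∷ β ∷ []) 2<k
  ... | γ , γ∉ = γ , (λ α≡γ → γ∉ (here (sym α≡γ))) , (λ β≡γ → γ∉ (there (here (sym β≡γ))))

  recoloured : ∀ {b β γ s} → Fresh b β s → (b , γ) ∈ s → ⊥
  recoloured fresh b∈ = proj₁ (All.lookup fresh b∈) refl

  far : ∀ {a b : AmE m n} {{_ : kind₁ a ≉ kind₁ b}} {{_ : kind₁ a ≉ kind₂ b}} {{_ : kind₂ a ≉ kind₁ b}}
        {{_ : kind₂ a ≉ kind₂ b}} {β α : Fin k} → Adj a b → β ≢ α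
  far ab = ⊥-elim (apart ab)

  avoids : ∀ {b β b′ γ s} → Fresh b β s → (b′ , γ) ∈ s → Adj b b′ → γ ≢ β
  avoids fresh b′∈ = proj₂ (All.lookup fresh b′∈)

  wv-or-other : (b : AmE m n) → b ≡ wv ⊎ wv ≢ b
  wv-or-other wv     = inj₁ refl
  wv-or-other cc     = inj₂ λ ()
  wv-or-other (vc _) = inj₂ λ ()
  wv-or-other (wx _) = inj₂ λ ()
  wv-or-other (vy _) = inj₂ λ ()

  both-sides : ∀ {t s α β} → Assigned t (vc s) α → Assigned t (vc (opposite s)) β →
               ∃ (Assigned t (vc left)) × ∃ (Assigned t (vc right))
  both-sides {s = left}  r r′ = (_ , r) , (_ , r′)
  both-sides {s = right} r r′ = (_ , r′) , (_ , r)

  module WDominates (v<k : 4 + n ≤ k) (w≤k : 1 + m ≤ k) where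

    wv-coloured-alice : ∀ {s} → WvColoured (Assigned s) → AliceWinsFrom s
    wv-coloured-alice (β , wvβ) E = holds⇒AliceTurn (wv-invariant v<k w≤k) (β , shows E wvβ)

    wv-coloured-bob : ∀ {s} → WvColoured (Assigned s) → BobLosesFrom s
    wv-coloured-bob (β , wvβ) E = holds⇒BobTurn (wv-invariant v<k w≤k) (β , shows E wvβ)

    wins : BobLosesFrom []
    wins = bob-plays (wv , Fin.fromℕ< (ℕP.<-≤-trans (s≤s z≤n) v<k) , []) respond
      where
      respond : ∀ b α → Fresh b α [] → AliceWinsFrom ((b , α) ∷ [])
      respond b α _ with wv-or-other b
      ... | inj₁ refl = wv-coloured-alice (α , here refl)
      ... | inj₂ wv≢b with another-colour (ℕP.<-≤-trans (s≤s (s≤s z≤n)) v<k) α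
      ...   | β , α≢β = alice-plays wv β ((wv≢b , λ _ → α≢β) ∷ []) (wv-coloured-bob (β , here refl))

  module VDominates (v≤k : 3 + n ≤ k) (w≤k : 1 + m ≤ k) where

    2<k : 2 < k
    2<k = ℕP.≤-trans (s≤s (s≤s (s≤s z≤n))) v≤k

    1<k : 1 < k
    1<k = ℕP.<-trans (s≤s (s≤s z≤n)) 2<k

    some-colour : Fin k
    some-colour = Fin.fromℕ< (ℕP.<-trans (s≤s z≤n) 1<k)

    settled-alice : ∀ {s} → Settled (Assigned s) → AliceWinsFrom s
    settled-alice S E =
      holds⇒AliceTurn (settled-invariant v≤k w≤k) (Settled-map (λ {a} {α} → shows E {a} {α}) S)

    settled-bob : ∀ {s} → Settled (Assigned s) → BobLosesFrom s
    settled-bob S E =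
      holds⇒BobTurn (settled-invariant v≤k w≤k) (Settled-map (λ {a} {α} → shows E {a} {α}) S)

    after-wv : ∀ α → AliceWinsFrom ((wv , α) ∷ [])
    after-wv α = alice-plays cc α (((λ ()) , far) ∷ [])
      (settled-bob ((α , there (here refl)) , inj₁ (α , here refl , inj₁ (there (here refl)))))

    after-cc : ∀ α → AliceWinsFrom ((cc , α) ∷ [])
    after-cc α = alice-plays wv α (((λ ()) , far) ∷ [])
      (settled-bob ((α , here refl) , inj₁ (α , there (here refl) , inj₁ (here refl))))

    module WithLeafAtV (j₀ : Fin n) where

      after-vy : ∀ j α → AliceWinsFrom ((vy j , α) ∷ [])
      after-vy j α with another-colour 1<k α
      ... | β , α≢β = alice-plays cc α (((λ ()) , far) ∷ [])
        (bob-plays (wv , β , ((λ ()) , far) ∷ ((λ ()) , λ _ → α≢β) ∷ []) respond)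
        where
        position : Assignment
        position = (cc , α) ∷ (vy j , α) ∷ []

        respond : ∀ b β₂ → Fresh b β₂ position → AliceWinsFrom ((b , β₂) ∷ position)
        respond b β₂ _ with wv-or-other b
        ... | inj₁ refl =
          settled-alice ((β₂ , here refl) , inj₁ (α , there (here refl) , inj₂ (j , there (there (here refl)))))
        ... | inj₂ wv≢b with third-colour 2<k α β₂
        ...   | γ , α≢γ , β₂≢γ =
          alice-plays wv γ ((wv≢b , λ _ → β₂≢γ) ∷ ((λ ()) , far) ∷ ((λ ()) , λ _ → α≢γ) ∷ [])
            (settled-bob ((γ , here refl)
                         , inj₁ (α , there (there (here refl)) , inj₂ (j , there (there (there (here refl)))))))

      module AfterWv (b₀ : AmE m n) (α β : Fin k) (α≢β : α ≢ β)
                     (cc≢b₀ : cc ≢ b₀) (vy≢b₀ : vy j₀ ≢ b₀) (via-cc : Adj (vy j₀) b₀ → Adj cc b₀) where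

        position : Assignment
        position = (wv , β) ∷ (b₀ , α) ∷ []

        cc-copies-wv : ∀ {b β₂} → cc ≢ b → Adj b wv → Fresh b β₂ position →
                       AliceWinsFrom ((b , β₂) ∷ position)
        cc-copies-wv cc≢b b~wv fresh =
          alice-plays cc β ((cc≢b , λ _ β₂≡β → avoids fresh (here refl) b~wv (sym β₂≡β))
                           ∷ ((λ ()) , far) ∷ (cc≢b₀ , λ _ → α≢β) ∷ [])
            (settled-bob ((β , there (there (here refl)))
                         , inj₁ (β , here refl , inj₁ (there (there (here refl))))))

        respond : ∀ b β₂ → Fresh b β₂ position → AliceWinsFrom ((b , β₂) ∷ position)
        respond wv β₂ fresh = ⊥-elim (recoloured fresh (here refl))
        respond cc β₂ fresh with β₂ FinP.≟ β
        ... | yes refl = settled-alice ((β , there (here refl)) , inj₁ (β , here refl , inj₁ (there (here refl))))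
        ... | no β₂≢β =
          alice-plays (vy j₀) β₂ (((λ ()) , far) ∷ ((λ ()) , λ _ β≡β₂ → β₂≢β (sym β≡β₂))
                                  ∷ (vy≢b₀ , avoids fresh (there (here refl)) ∘ via-cc) ∷ [])
            (settled-bob ((β , there (there (here refl)))
                         , inj₁ (β₂ , there (here refl) , inj₂ (j₀ , here refl))))
        respond (vc _) β₂ fresh = cc-copies-wv (λ ()) (meet av (inj₁ refl) (inj₂ refl)) fresh
        respond (wx _) β₂ fresh = cc-copies-wv (λ ()) (meet aw (inj₁ refl) (inj₁ refl)) fresh
        respond (vy _) β₂ fresh = cc-copies-wv (λ ()) (meet av (inj₁ refl) (inj₂ refl)) fresh

        bob : BobLosesFrom position
        bob = bob-plays (cc , β , ((λ ()) , far) ∷ (cc≢b₀ , λ _ → α≢β) ∷ []) respond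

      wv-answers : ∀ b₀ α → wv ≢ b₀ → cc ≢ b₀ → vy j₀ ≢ b₀ → (Adj (vy j₀) b₀ → Adj cc b₀) →
                   AliceWinsFrom ((b₀ , α) ∷ [])
      wv-answers b₀ α wv≢b₀ cc≢b₀ vy≢b₀ via-cc with another-colour 1<k α
      ... | β , α≢β =
        alice-plays wv β ((wv≢b₀ , λ _ → α≢β) ∷ []) (AfterWv.bob b₀ α β α≢β cc≢b₀ vy≢b₀ via-cc)

      first : ∀ b α → Fresh b α [] → AliceWinsFrom ((b , α) ∷ [])
      first wv     α _ = after-wv α
      first cc     α _ = after-cc α
      first (vy j) α _ = after-vy j α
      first (vc s) α _ = wv-answers (vc s) α (λ ()) (λ ()) (λ ()) (λ _ → cc~vc s)
      first (wx i) α _ = wv-answers (wx i) α (λ ()) (λ ()) (λ ()) (⊥-elim ∘ apart)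

      wins : BobLosesFrom []
      wins = bob-plays (wv , some-colour , []) first

    module ThreeColours (k≤3 : k ≤ 3) where

      no-vy : ¬ Fin n
      no-vy j = ℕP.<⇒≱ (s≤s k≤3) (ℕP.≤-trans (ℕP.+-monoʳ-≤ 3 (ℕP.≤-trans (s≤s z≤n) (FinP.toℕ<n j))) v≤k)

      m≤2 : m ≤ 2
      m≤2 = ℕP.≤-pred (ℕP.≤-trans w≤k k≤3)

      -- Alice gives vc s and wx i the same colour, so that wv sees one colour fewer.
      module AfterMatch (s : Side) (i : Fin m) (α : Fin k) where

        position : Assignment
        position = (wx i , α) ∷ (vc s , α) ∷ []

        module AfterThreeColours (i′ : Fin m) (i′≢i : i′ ≢ i) (β₂ γ : Fin k)
                                 (α≢β₂ : α ≢ β₂) (α≢γ : α ≢ γ) (β₂≢γ : β₂ ≢ γ) where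

          position₃ : Assignment
          position₃ = (cc , γ) ∷ (wx i′ , β₂) ∷ position

          wv~wx : ∀ {i} → Adj (wv {m} {n}) (wx i)
          wv~wx = meet aw (inj₁ refl) (inj₁ refl)

          respond : ∀ b β₃ → Fresh b β₃ position₃ → AliceWinsFrom ((b , β₃) ∷ position₃)
          respond wv β₃ fresh = settled-alice ((β₃ , here refl) , inj₁ (γ , there (here refl) , inj₁ wv-γ))
            where
            -- wv sees α and β₂ at w, so Bob could only use the third colour.
            β₃≡γ : β₃ ≡ γ
            β₃≡γ = third-unique k≤3 α β₂ β₃ γ α≢β₂
              (λ β₃≡α → avoids fresh (there (there (here refl))) wv~wx (sym β₃≡α))
              (λ β₃≡β₂ → avoids fresh (there (here refl)) wv~wx (sym β₃≡β₂))
              (λ γ≡α → α≢γ (sym γ≡α)) (λ γ≡β₂ → β₂≢γ (sym γ≡β₂))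

            wv-γ : (wv , γ) ∈ (wv , β₃) ∷ position₃
            wv-γ = here (cong (wv ,_) (sym β₃≡γ))
          respond cc β₃ fresh = ⊥-elim (recoloured fresh (here refl))
          respond (vc t) β₃ fresh with same-or-opposite s t
          ... | inj₁ refl = ⊥-elim (recoloured fresh (there (there (there (here refl)))))
          ... | inj₂ refl =
            alice-plays wv γ (((λ ()) , λ _ β₃≡γ → avoids fresh (here refl) (Adj-sym (cc~vc (opposite s))) (sym β₃≡γ))
                             ∷ ((λ ()) , far) ∷ ((λ ()) , λ _ → β₂≢γ)
                             ∷ ((λ ()) , λ _ → α≢γ) ∷ ((λ ()) , λ _ → α≢γ) ∷ [])
              (settled-bob ((γ , here refl) , inj₁ (γ , there (there (here refl)) , inj₁ (here refl))))
          respond (wx i″) β₃ fresh with i″ FinP.≟ i | i″ FinP.≟ i′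
          ... | yes refl | _        = ⊥-elim (recoloured fresh (there (there (here refl))))
          ... | no _     | yes refl = ⊥-elim (recoloured fresh (there (here refl)))
          ... | no i″≢i  | no i″≢i′ =
            ⊥-elim (no-three-distinct m≤2 i i′ i″ (λ i≡i′ → i′≢i (sym i≡i′)) (λ i≡i″ → i″≢i (sym i≡i″))
                                                   (λ i′≡i″ → i″≢i′ (sym i′≡i″)))
          respond (vy j) _ _ = ⊥-elim (no-vy j)

          bob : BobLosesFrom position₃
          bob = bob-plays (vc (opposite s) , β₂ , witness) respond
            where
            witness : Fresh (vc (opposite s)) β₂ position₃
            witness = ((λ ()) , λ _ γ≡β₂ → β₂≢γ (sym γ≡β₂)) ∷ ((λ ()) , far) ∷ ((λ ()) , far)
                    ∷ (vc-opposite s , λ _ → α≢β₂) ∷ []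

        respond : ∀ b β₂ → Fresh b β₂ position → AliceWinsFrom ((b , β₂) ∷ position)
        respond wv β₂ fresh =
          alice-plays cc β₂ (((λ ()) , far) ∷ ((λ ()) , far) ∷ ((λ ()) , λ _ → α≢β₂) ∷ [])
            (settled-bob ((β₂ , there (here refl)) , inj₁ (β₂ , here refl , inj₁ (there (here refl)))))
          where
          α≢β₂ : α ≢ β₂
          α≢β₂ = avoids fresh (there (here refl)) (meet av (inj₂ refl) (inj₁ refl))
        respond cc β₂ fresh =
          alice-plays wv β₂ (((λ ()) , far) ∷ ((λ ()) , λ _ → α≢β₂) ∷ ((λ ()) , λ _ → α≢β₂) ∷ [])
            (settled-bob ((β₂ , here refl) , inj₁ (β₂ , there (here refl) , inj₁ (here refl))))
          where
          α≢β₂ : α ≢ β₂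
          α≢β₂ = avoids fresh (there (here refl)) (cc~vc s)
        respond (vc t) β₂ fresh with same-or-opposite s t
        ... | inj₁ refl = ⊥-elim (recoloured fresh (there (here refl)))
        ... | inj₂ refl with third-colour 2<k α β₂
        ...   | γ , α≢γ , β₂≢γ =
          alice-plays wv γ (((λ ()) , λ _ → β₂≢γ) ∷ ((λ ()) , λ _ → α≢γ) ∷ ((λ ()) , λ _ → α≢γ) ∷ [])
            (settled-bob ((γ , here refl) , inj₂ (both-sides (there (there (there (here refl)))) (there (here refl)))))
        respond (wx i′) β₂ fresh with i′ FinP.≟ i
        ... | yes refl = ⊥-elim (recoloured fresh (here refl))
        ... | no i′≢i with third-colour 2<k α β₂
        ...   | γ , α≢γ , β₂≢γ =
          alice-plays cc γ (((λ ()) , far) ∷ ((λ ()) , far) ∷ ((λ ()) , λ _ → α≢γ) ∷ [])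
            (AfterThreeColours.bob i′ i′≢i β₂ γ α≢β₂ α≢γ β₂≢γ)
          where
          α≢β₂ : α ≢ β₂
          α≢β₂ = avoids fresh (here refl) (meet aw (inj₁ refl) (inj₁ refl))
        respond (vy j) _ _ = ⊥-elim (no-vy j)

        bob : BobLosesFrom position
        bob with another-colour 1<k α
        ... | β , α≢β = bob-plays (cc , β , ((λ ()) , far) ∷ ((λ ()) , λ _ → α≢β) ∷ []) respond

      module AfterBothVc (no-wx : ¬ Fin m) (s : Side) (α β : Fin k) (α≢β : α ≢ β) where

        position : Assignment
        position = (vc (opposite s) , β) ∷ (vc s , α) ∷ []

        respond : ∀ γ → α ≢ γ → β ≢ γ → ∀ b β₂ → Fresh b β₂ position →
                  AliceWinsFrom ((b , β₂) ∷ position)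
        respond _ _ _ wv β₂ _ =
          settled-alice ((β₂ , here refl) , inj₂ (both-sides (there (there (here refl))) (there (here refl))))
        respond γ α≢γ β≢γ cc β₂ _ =
          alice-plays wv γ (((λ ()) , far) ∷ ((λ ()) , λ _ → β≢γ) ∷ ((λ ()) , λ _ → α≢γ) ∷ [])
            (settled-bob ((γ , here refl)
                         , inj₂ (both-sides (there (there (there (here refl)))) (there (there (here refl))))))
        respond _ _ _ (vc t) _ fresh with same-or-opposite s t
        ... | inj₁ refl = ⊥-elim (recoloured fresh (there (here refl)))
        ... | inj₂ refl = ⊥-elim (recoloured fresh (here refl))
        respond _ _ _ (wx i) _ _ = ⊥-elim (no-wx i)
        respond _ _ _ (vy j) _ _ = ⊥-elim (no-vy j)

        bob : BobLosesFrom position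
        bob with third-colour 2<k α β
        ... | γ , α≢γ , β≢γ =
          bob-plays (cc , γ , ((λ ()) , λ _ → β≢γ) ∷ ((λ ()) , λ _ → α≢γ) ∷ []) (respond γ α≢γ β≢γ)

      first : ∀ b α → Fresh b α [] → AliceWinsFrom ((b , α) ∷ [])
      first wv     α _ = after-wv α
      first cc     α _ = after-cc α
      first (vy j) _ _ = ⊥-elim (no-vy j)
      first (wx i) α _ = alice-plays (vc left) α (((λ ()) , far) ∷ [])
        (λ E → AfterMatch.bob left i α (Exactly-↭ (swap _ _ ↭-refl) E))
      first (vc s) α _ with inhabited-or-empty m
      ... | inj₁ i = alice-plays (wx i) α (((λ ()) , far) ∷ []) (AfterMatch.bob s i α)
      ... | inj₂ no-wx with another-colour 1<k α
      ...   | β , α≢β = alice-plays (vc (opposite s)) β ((vc-opposite s , λ _ → α≢β) ∷ [])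
                          (AfterBothVc.bob no-wx s α β α≢β)

      wins : BobLosesFrom []
      wins = bob-plays (wv , some-colour , []) first

module AmaryllisGame {G : Graph} {m n : ℕ} (φ : AmV m n → Fin (V G))
                     (φ-injective : ∀ a b → φ a ≡ φ b → a ≡ b)
                     (φ-adj : ∀ a b → adj G (φ a) (φ b) ≡ amAdj a b)
                     (φ-covers : ∀ u v → adj G u v ≡ true → (∃[ a ] (φ a ≡ u)) × (∃[ b ] (φ b ≡ v))) where

  open Embedding {G} φ φ-injective φ-adj φ-covers
  module P k = Play {G} φ φ-injective φ-adj φ-covers k

  star-line-clique : ∀ {ω p} (f : Fin ω → AmE m n) → (∀ {i j} → f i ≡ f j → i ≡ j) →
                     (∀ i → Incident (f i) p) → IsLineClique G (tabulate (toE ∘ f))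
  star-line-clique f f-injective at-p = AllPairsₚ.tabulate⁺ λ {i} {j} i≢j →
    (λ same → i≢j (f-injective (toE-injective same))) , Adj⇒ShareEnd (meet _ (at-p i) (at-p j))

  line-clique⇒AmClique : ∀ {es} → IsLineClique G es → AmClique (map fromE es)
  line-clique⇒AmClique = AllPairsₚ.map⁺ ∘ AllPairs.map λ {e} {f} (e≠f , sh) →
      (λ same → e≠f (cong end₁ (from-same same) , cong end₂ (from-same same)))
    , ShareEnd⇒Adj (subst₂ ShareEnd (sym (toE-fromE e)) (sym (toE-fromE f)) sh)
    where
    from-same : ∀ {e f} → fromE e ≡ fromE f → e ≡ f
    from-same {e} {f} same = trans (sym (toE-fromE e)) (trans (cong toE same) (toE-fromE f))

  nice-from-star : ∀ {ω p} (f : Fin ω → AmE m n) → (∀ {i j} → f i ≡ f j → i ≡ j) →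
                   (∀ i → Incident (f i) p) → 3 ≤ ω → 1 + m ≤ ω → 3 + n ≤ ω →
                   AliceWinsB G ω → LineBNice G
  nice-from-star {ω} f f-injective at-p 3≤ω w≤ω v≤ω win =
    ω , ((tabulate (toE ∘ f) , clique , length-tabulate (toE ∘ f)) , bounded) , win ,
    λ k k<ω → clique⇒¬AliceWins clique (subst (k <_) (sym (length-tabulate (toE ∘ f))) k<ω)
    where
    clique : IsLineClique G (tabulate (toE ∘ f))
    clique = star-line-clique f f-injective at-p

    bounded : ∀ es → IsLineClique G es → length es ≤ ω
    bounded es es-clique =
      subst (_≤ ω) (length-map fromE es) (clique-length≤ 3≤ω w≤ω v≤ω (line-clique⇒AmClique es-clique))

  nice-when-m≤n+2 : m ≤ 2 + n → LineBNice G
  nice-when-m≤n+2 m≤2+n =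
    nice-from-star v-star v-star-injective v-star-at-v (s≤s (s≤s (s≤s z≤n))) (s≤s m≤2+n) ℕP.≤-refl
    (wins (inhabited-or-empty n) (P.Exactly-empty (3 + n)))
    where
    open P.VDominates (3 + n) ℕP.≤-refl (s≤s m≤2+n)

    wins : Fin n ⊎ ¬ Fin n → P.BobLosesFrom (3 + n) []
    wins (inj₁ j₀)    = WithLeafAtV.wins j₀
    wins (inj₂ no-vy) = ThreeColours.wins (ℕP.+-monoʳ-≤ 3 (ℕP.≮⇒≥ λ 0<n → no-vy (Fin.fromℕ< 0<n)))

  nice-when-n+3≤m : 3 + n ≤ m → LineBNice G
  nice-when-n+3≤m v<w =
    nice-from-star w-star w-star-injective w-star-at-w (ℕP.≤-trans (s≤s (s≤s (s≤s z≤n))) v≤ω) ℕP.≤-refl v≤ω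
    (P.WDominates.wins (suc m) (s≤s v<w) ℕP.≤-refl (P.Exactly-empty (suc m)))
    where
    v≤ω : 3 + n ≤ suc m
    v≤ω = ℕP.m≤n⇒m≤1+n v<w

lemma58 : (G : Graph) (m n : ℕ) → AmaryllisPlusIsolated G m n → LineBNice G
lemma58 G m n (φ , φ-injective , φ-adj , φ-covers) with m ℕ.≤? 2 + n
... | yes m≤2+n = AmaryllisGame.nice-when-m≤n+2 φ φ-injective φ-adj φ-covers m≤2+n
... | no m≰2+n  = AmaryllisGame.nice-when-n+3≤m φ φ-injective φ-adj φ-covers (ℕP.≰⇒> m≰2+n)
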